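{- Let $F=GF(8)$, $\alpha$ a primitive element, $\alpha^{ -\infty}=0$, and let $k,r,s\in\{ -\infty,0,1,\dots,6\}$ with $r\neq s$. Let $X,X'\in H_{\alpha^k}$ be at Hamming distance $4$ and belong to the same $(\alpha^r,\alpha^s)$-component of $H_{\alpha^k}$. Then there is no $l$ such that both $X+e_{\alpha^r}+e_{\alpha^s}$ and $X'+e_{\alpha^r}+e_{\alpha^s}$ belong to $H_{\alpha^l}$.
   Context: Binary vectors of length $8$ have coordinates indexed by elements of $F$ and are identified with their supports $X\subseteq F$; addition is symmetric difference; $e_a$ is the vector with support $\{a\}$. For $a\in F$, $H_a=\{X\subseteq F: |X|\text{ odd},\ \sum_{x\in X}(x+a)^3=0\}$ (an extended perfect code). Two codewords of a code are $(a,b)$-adjacent if they are at distance $4$ and differ in coordinates $a$ and $b$; an $(a,b)$-component is a maximal set of codewords connected by paths of successive $(a,b)$-adjacent codewords. -}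

module Defs where

open import Data.Bool using (Bool; true; false; _xor_; _∧_; if_then_else_)
open import Data.Nat using (ℕ; zero; suc; _+_; _%_)
open import Data.Fin using (Fin; zero; suc; toℕ; _≟_)
open import Relation.Nullary.Decidable using (⌊_⌋)
open import Data.Maybe using (Maybe; just; nothing)
open import Data.Product using (_×_; _,_)
open import Data.Vec using (Vec; []; _∷_; lookup; tabulate; zipWith; foldr)
open import Relation.Binary.PropositionalEquality using (_≡_)
open import Relation.Binary.Construct.Closure.ReflexiveTransitive using (Star)

-- The field F = GF(8) = GF(2)[x]/(x^3 + x + 1).
-- An element is a triple (c0 , c1 , c2) meaning c0 + c1 x + c2 x^2.
-- Elements are encoded as Fin 8 via the binary expansion c0 + 2 c1 + 4 c2.

F : Set
F = Fin 8

Bits : Set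
Bits = Bool × Bool × Bool

toBits : F → Bits
toBits zero = false , false , false
toBits (suc zero) = true , false , false
toBits (suc (suc zero)) = false , true , false
toBits (suc (suc (suc zero))) = true , true , false
toBits (suc (suc (suc (suc zero)))) = false , false , true
toBits (suc (suc (suc (suc (suc zero))))) = true , false , true
toBits (suc (suc (suc (suc (suc (suc zero)))))) = false , true , true
toBits (suc (suc (suc (suc (suc (suc (suc zero))))))) = true , true , true

fromBits : Bits → F
fromBits (false , false , false) = zero
fromBits (true , false , false) = suc zero
fromBits (false , true , false) = suc (suc zero)
fromBits (true , true , false) = suc (suc (suc zero))
fromBits (false , false , true) = suc (suc (suc (suc zero)))
fromBits (true , false , true) = suc (suc (suc (suc (suc zero))))
fromBits (false , true , true) = suc (suc (suc (suc (suc (suc zero)))))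
fromBits (true , true , true) = suc (suc (suc (suc (suc (suc (suc zero))))))

addBits : Bits → Bits → Bits
addBits (a0 , a1 , a2) (b0 , b1 , b2) = a0 xor b0 , a1 xor b1 , a2 xor b2

scaleBits : Bool → Bits → Bits
scaleBits c (b0 , b1 , b2) = c ∧ b0 , c ∧ b1 , c ∧ b2

-- multiplication by x, using x^3 = x + 1
mulXBits : Bits → Bits
mulXBits (c0 , c1 , c2) = c2 , c0 xor c2 , c1

mulBits : Bits → Bits → Bits
mulBits (a0 , a1 , a2) b =
  addBits (scaleBits a0 b)
    (addBits (scaleBits a1 (mulXBits b)) (scaleBits a2 (mulXBits (mulXBits b))))

infixl 6 _+F_
infixl 7 _*F_

_+F_ : F → F → F
a +F b = fromBits (addBits (toBits a) (toBits b))

_*F_ : F → F → F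
a *F b = fromBits (mulBits (toBits a) (toBits b))

0F 1F : F
0F = zero
1F = suc zero

cube : F → F
cube x = x *F x *F x

_^F_ : F → ℕ → F
a ^F zero = 1F
a ^F suc n = a *F (a ^F n)

Primitive : F → Set
Primitive α = ∀ (i j : Fin 7) → α ^F toℕ i ≡ α ^F toℕ j → i ≡ j

-- Exponents in {-∞, 0, 1, ..., 6}: nothing stands for -∞.
Exp : Set
Exp = Maybe (Fin 7)

pow : F → Exp → F
pow α nothing = 0F
pow α (just i) = α ^F toℕ i

-- Binary vectors of length 8 indexed by F, identified with supports.

Word : Set
Word = Vec Bool 8

infixl 6 _⊕_
_⊕_ : Word → Word → Word
_⊕_ = zipWith _xor_

e : F → Word
e a = tabulate (λ x → ⌊ x ≟ a ⌋)

count : ∀ {n} → Vec Bool n → ℕ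
count [] = 0
count (true ∷ bs) = suc (count bs)
count (false ∷ bs) = count bs

dist : Word → Word → ℕ
dist X Y = count (X ⊕ Y)

sumOver : Word → (F → F) → F
sumOver X f = go (tabulate (λ x → x)) X
  where
  go : ∀ {n} → Vec F n → Vec Bool n → F
  go [] [] = 0F
  go (x ∷ xs) (b ∷ bs) = if b then f x +F go xs bs else go xs bs

_∈ₛ_ : F → Word → Set
a ∈ₛ X = lookup X a ≡ true

Code : Set₁
Code = Word → Set

H : F → Code
H a X = (count X % 2 ≡ 1) × (sumOver X (λ x → cube (x +F a)) ≡ 0F)

Adjacent : Code → F → F → Word → Word → Set
Adjacent C a b X Y = C X × C Y × (dist X Y ≡ 4) × (a ∈ₛ (X ⊕ Y)) × (b ∈ₛ (X ⊕ Y))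

SameComponent : Code → F → F → Word → Word → Set
SameComponent C a b X Y = C X × C Y × Star (Adjacent C a b) X Y

-- Write σ_d X = Σ_{x ∈ X} (x + d)³. As σ_d is additive in X, the word X + e_b + e_c lies in
-- H_d only if σ_d X = (b + d)³ + (c + d)³, and (b, c)-adjacency flips both coordinates b and c,
-- so X_b + X_c is constant on a component. What remains is a statement about pairs X, X′ ∈ H_a
-- at distance 4 with X_b + X_c = X′_b + X′_c, which is checked exhaustively; cubing is a
-- bijection of GF(8), so c is determined by b, d and σ_d X, which keeps the search small.
-- Distinct exponents give distinct field elements because a primitive element is nonzero.
module Submission where

open import Defs
open import Data.Bool using (Bool; true; false; not; _xor_; if_then_else_)
import Data.Bool as Bool
open import Data.Bool.Properties using (not-distribˡ-xor; not-distribʳ-xor; not-involutive)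
open import Data.Empty using (⊥-elim)
open import Data.Fin using (zero; suc; toℕ; _≟_)
open import Data.Fin.Properties using (all?)
open import Data.Fin.Subset using (Subset; inside; outside)
open import Data.Maybe using (just; nothing)
open import Data.Nat using (_%_)
import Data.Nat as ℕ
open import Data.Product using (Σ; _×_; _,_)
open import Data.Vec using (Vec; []; _∷_; lookup; zipWith; tabulate)
open import Data.Vec.Properties using (lookup-zipWith)
open import Function using (_∘_; id)
open import Relation.Binary.Construct.Closure.ReflexiveTransitive using (Star; ε; _◅_)
open import Relation.Binary.PropositionalEquality
  using (_≡_; _≢_; refl; sym; trans; cong; cong₂; subst; module ≡-Reasoning)
open import Relation.Nullary using (¬_; Dec; ¬?)
open import Relation.Nullary.Decidable using (map′; _×-dec_; _→-dec_; from-yes)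
open import Relation.Unary using (Pred; Decidable)

open ≡-Reasoning

allSubset? : ∀ {ℓ n} {P : Pred (Subset n) ℓ} → Decidable P → Dec (∀ p → P p)
allSubset? {n = ℕ.zero} P? = map′ (λ { p [] → p }) (λ f → f []) (P? [])
allSubset? {n = ℕ.suc n} P? =
  map′ (λ { (pin , pout) (inside ∷ p) → pin p ; (pin , pout) (outside ∷ p) → pout p })
       (λ f → f ∘ (inside ∷_) , f ∘ (outside ∷_))
       (allSubset? (P? ∘ (inside ∷_)) ×-dec allSubset? (P? ∘ (outside ∷_)))

+F-assoc : ∀ x y z → (x +F y) +F z ≡ x +F (y +F z)
+F-assoc = from-yes (all? λ x → all? λ y → all? λ z → (x +F y) +F z ≟ x +F (y +F z))

+F-comm : ∀ x y → x +F y ≡ y +F x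
+F-comm = from-yes (all? λ x → all? λ y → x +F y ≟ y +F x)

+F-identityʳ : ∀ x → x +F 0F ≡ x
+F-identityʳ = from-yes (all? λ x → x +F 0F ≟ x)

+F-same : ∀ x → x +F x ≡ 0F
+F-same = from-yes (all? λ x → x +F x ≟ 0F)

+F-cancelʳ : ∀ x y → (x +F y) +F y ≡ x
+F-cancelʳ x y = begin
  (x +F y) +F y  ≡⟨ +F-assoc x y y ⟩
  x +F (y +F y)  ≡⟨ cong (x +F_) (+F-same y) ⟩
  x +F 0F        ≡⟨ +F-identityʳ x ⟩
  x              ∎

+F-cancelˡ : ∀ x y → (x +F y) +F x ≡ y
+F-cancelˡ x y = trans (cong (_+F x) (+F-comm x y)) (+F-cancelʳ y x)

+F-swapˡ : ∀ x y z → x +F (y +F z) ≡ y +F (x +F z)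
+F-swapˡ x y z = begin
  x +F (y +F z)  ≡⟨ sym (+F-assoc x y z) ⟩
  (x +F y) +F z  ≡⟨ cong (_+F z) (+F-comm x y) ⟩
  (y +F x) +F z  ≡⟨ +F-assoc y x z ⟩
  y +F (x +F z)  ∎

+F-cancel-common : ∀ x y z → (x +F y) +F (x +F z) ≡ y +F z
+F-cancel-common x y z = begin
  (x +F y) +F (x +F z)  ≡⟨ +F-assoc x y (x +F z) ⟩
  x +F (y +F (x +F z))  ≡⟨ cong (x +F_) (+F-swapˡ y x z) ⟩
  x +F (x +F (y +F z))  ≡⟨ sym (+F-assoc x x (y +F z)) ⟩
  (x +F x) +F (y +F z)  ≡⟨ cong (_+F (y +F z)) (+F-same x) ⟩
  0F +F (y +F z)        ≡⟨ +F-comm 0F (y +F z) ⟩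
  (y +F z) +F 0F        ≡⟨ +F-identityʳ (y +F z) ⟩
  y +F z                ∎

+F-transpose : ∀ x y d → x +F d ≡ y → x ≡ y +F d
+F-transpose x _ d refl = sym (+F-cancelʳ x d)

+F-≡0⇒≡ : ∀ {x y} → x +F y ≡ 0F → x ≡ y
+F-≡0⇒≡ {x} {y} x+y≡0 = begin
  x              ≡⟨ sym (+F-cancelʳ x y) ⟩
  (x +F y) +F y  ≡⟨ cong (_+F y) x+y≡0 ⟩
  0F +F y        ≡⟨ +F-comm 0F y ⟩
  y +F 0F        ≡⟨ +F-identityʳ y ⟩
  y              ∎

*F-nonzero : ∀ x y → x ≢ 0F → y ≢ 0F → x *F y ≢ 0F
*F-nonzero = from-yes (all? λ x → all? λ y →
  ¬? (x ≟ 0F) →-dec ¬? (y ≟ 0F) →-dec ¬? (x *F y ≟ 0F))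

-- x ↦ x⁵ inverts cubing because 3 · 5 ≡ 1 (mod 7).
cubeRoot : F → F
cubeRoot x = x ^F 5

cubeRoot-cube : ∀ x → cubeRoot (cube x) ≡ x
cubeRoot-cube = from-yes (all? λ x → cubeRoot (cube x) ≟ x)

cube≡⇒≡cubeRoot : ∀ x y → cube x ≡ y → x ≡ cubeRoot y
cube≡⇒≡cubeRoot x _ refl = sym (cubeRoot-cube x)

^F-nonzero : ∀ {α} → α ≢ 0F → ∀ n → α ^F n ≢ 0F
^F-nonzero α≢0 ℕ.zero ()
^F-nonzero α≢0 (ℕ.suc n) = *F-nonzero _ _ α≢0 (^F-nonzero α≢0 n)

primitive⇒nonzero : ∀ {α} → Primitive α → α ≢ 0F
primitive⇒nonzero pr refl with pr (suc zero) (suc (suc zero)) refl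
... | ()

pow-injective : ∀ {α} → Primitive α → ∀ r s → pow α r ≡ pow α s → r ≡ s
pow-injective pr nothing  nothing  _  = refl
pow-injective pr nothing  (just j) eq = ⊥-elim (^F-nonzero (primitive⇒nonzero pr) (toℕ j) (sym eq))
pow-injective pr (just i) nothing  eq = ⊥-elim (^F-nonzero (primitive⇒nonzero pr) (toℕ i) eq)
pow-injective pr (just i) (just j) eq = cong just (pr i j eq)

-- The fold inside sumOver is local to its definition, so it is mirrored here to reason about it.
sumSelected : ∀ {n} → Vec F n → Vec Bool n → (F → F) → F
sumSelected [] [] f = 0F
sumSelected (x ∷ xs) (b ∷ bs) f = if b then f x +F sumSelected xs bs f else sumSelected xs bs f

sumOver≡sumSelected : ∀ X f → sumOver X f ≡ sumSelected (tabulate id) X f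
sumOver≡sumSelected (b₀ ∷ b₁ ∷ b₂ ∷ b₃ ∷ b₄ ∷ b₅ ∷ b₆ ∷ b₇ ∷ []) f = refl

sumSelected-⊕ : ∀ {n} (xs : Vec F n) bs cs f →
  sumSelected xs (zipWith _xor_ bs cs) f ≡ sumSelected xs bs f +F sumSelected xs cs f
sumSelected-⊕ [] [] [] f = sym (+F-identityʳ 0F)
sumSelected-⊕ (x ∷ xs) (b ∷ bs) (c ∷ cs) f rewrite sumSelected-⊕ xs bs cs f with b | c
... | false | false = refl
... | true  | false = sym (+F-assoc (f x) (sumSelected xs bs f) (sumSelected xs cs f))
... | false | true  = +F-swapˡ (f x) (sumSelected xs bs f) (sumSelected xs cs f)
... | true  | true  = sym (+F-cancel-common (f x) (sumSelected xs bs f) (sumSelected xs cs f))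

sumOver-⊕ : ∀ X Y f → sumOver (X ⊕ Y) f ≡ sumOver X f +F sumOver Y f
sumOver-⊕ X Y f = begin
  sumOver (X ⊕ Y) f                          ≡⟨ sumOver≡sumSelected (X ⊕ Y) f ⟩
  sumSelected (tabulate id) (X ⊕ Y) f              ≡⟨ sumSelected-⊕ (tabulate id) X Y f ⟩
  sumSelected (tabulate id) X f +F sumSelected (tabulate id) Y f
    ≡⟨ sym (cong₂ _+F_ (sumOver≡sumSelected X f) (sumOver≡sumSelected Y f)) ⟩
  sumOver X f +F sumOver Y f                 ∎

sumOver-e : ∀ a f → sumOver (e a) f ≡ f a
sumOver-e zero f = +F-identityʳ _
sumOver-e (suc zero) f = +F-identityʳ _
sumOver-e (suc (suc zero)) f = +F-identityʳ _
sumOver-e (suc (suc (suc zero))) f = +F-identityʳ _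
sumOver-e (suc (suc (suc (suc zero)))) f = +F-identityʳ _
sumOver-e (suc (suc (suc (suc (suc zero))))) f = +F-identityʳ _
sumOver-e (suc (suc (suc (suc (suc (suc zero)))))) f = +F-identityʳ _
sumOver-e (suc (suc (suc (suc (suc (suc (suc zero))))))) f = +F-identityʳ _

cubeSum : F → Word → F
cubeSum d X = sumOver X (λ x → cube (x +F d))

pairCubeSum : F → F → F → F
pairCubeSum d b c = cube (b +F d) +F cube (c +F d)

cubeSum-shift : ∀ d X b c → cubeSum d (X ⊕ e b ⊕ e c) ≡ cubeSum d X +F pairCubeSum d b c
cubeSum-shift d X b c = begin
  cubeSum d (X ⊕ e b ⊕ e c)
    ≡⟨ sumOver-⊕ (X ⊕ e b) (e c) σ ⟩
  cubeSum d (X ⊕ e b) +F sumOver (e c) σ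
    ≡⟨ cong₂ _+F_ (sumOver-⊕ X (e b) σ) (sumOver-e c σ) ⟩
  (cubeSum d X +F sumOver (e b) σ) +F cube (c +F d)
    ≡⟨ cong (λ t → (cubeSum d X +F t) +F cube (c +F d)) (sumOver-e b σ) ⟩
  (cubeSum d X +F cube (b +F d)) +F cube (c +F d)
    ≡⟨ +F-assoc (cubeSum d X) (cube (b +F d)) (cube (c +F d)) ⟩
  cubeSum d X +F pairCubeSum d b c
    ∎
  where
  σ : F → F
  σ x = cube (x +F d)

shifted-codeword : ∀ d X b c → H d (X ⊕ e b ⊕ e c) → cubeSum d X ≡ pairCubeSum d b c
shifted-codeword d X b c (_ , σY≡0) = +F-≡0⇒≡ (trans (sym (cubeSum-shift d X b c)) σY≡0)

xor-≡true⇒≡not : ∀ {x y} → x xor y ≡ true → y ≡ not x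
xor-≡true⇒≡not {false} {true} _ = refl
xor-≡true⇒≡not {true} {false} _ = refl

not-xor-not : ∀ x y → not x xor not y ≡ x xor y
not-xor-not x y = begin
  not x xor not y    ≡⟨ sym (not-distribʳ-xor (not x) y) ⟩
  not (not x xor y)  ≡⟨ cong not (sym (not-distribˡ-xor x y)) ⟩
  not (not (x xor y)) ≡⟨ not-involutive (x xor y) ⟩
  x xor y            ∎

pairParity : F → F → Word → Bool
pairParity b c X = lookup X b xor lookup X c

∈-⊕⇒lookup≡not : ∀ X Y a → a ∈ₛ (X ⊕ Y) → lookup Y a ≡ not (lookup X a)
∈-⊕⇒lookup≡not X Y a a∈ = xor-≡true⇒≡not (trans (sym (lookup-zipWith _xor_ a X Y)) a∈)

adjacent-pairParity : ∀ C b c {X Y} → Adjacent C b c X Y → pairParity b c X ≡ pairParity b c Y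
adjacent-pairParity C b c {X} {Y} (_ , _ , _ , b∈ , c∈) = begin
  lookup X b xor lookup X c              ≡⟨ sym (not-xor-not (lookup X b) (lookup X c)) ⟩
  not (lookup X b) xor not (lookup X c)
    ≡⟨ sym (cong₂ _xor_ (∈-⊕⇒lookup≡not X Y b b∈) (∈-⊕⇒lookup≡not X Y c c∈)) ⟩
  lookup Y b xor lookup Y c              ∎

component-pairParity : ∀ C b c {X Y} → Star (Adjacent C b c) X Y → pairParity b c X ≡ pairParity b c Y
component-pairParity C b c ε = refl
component-pairParity C b c (adj ◅ path) =
  trans (adjacent-pairParity C b c adj) (component-pairParity C b c path)

pairCubeSum-cancel : ∀ d b c → pairCubeSum d b c +F cube (b +F d) ≡ cube (c +F d)
pairCubeSum-cancel d b c = +F-cancelˡ (cube (b +F d)) (cube (c +F d))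

-- Field elements are given explicitly here and above: unifying expressions of F unfolds them
-- into bit arithmetic, which makes type checking very slow.
partner-unique : ∀ d b c v → v ≡ pairCubeSum d b c → c ≡ cubeRoot (v +F cube (b +F d)) +F d
partner-unique d b c _ refl =
  let v = pairCubeSum d b c +F cube (b +F d) in
  +F-transpose c (cubeRoot v) d (cube≡⇒≡cubeRoot (c +F d) v (sym (pairCubeSum-cancel d b c)))

H? : ∀ a X → Dec (H a X)
H? a X = (count X % 2 ℕ.≟ 1) ×-dec (cubeSum a X ≟ 0F)

-- Given σ_d X = v, the only c with (b + d)³ + (c + d)³ = v is the c below (see partner-unique),
-- so the check runs over b alone.
NoParityPartner : F → F → Word → Word → Set
NoParityPartner d v X X′ = ∀ b → let c = cubeRoot (v +F cube (b +F d)) +F d in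
  b ≢ c → pairParity b c X ≢ pairParity b c X′

noParityPartner? : ∀ d v X X′ → Dec (NoParityPartner d v X X′)
noParityPartner? d v X X′ = all? λ b → let c = cubeRoot (v +F cube (b +F d)) +F d in
  ¬? (b ≟ c) →-dec ¬? (pairParity b c X Bool.≟ pairParity b c X′)

NoCommonShiftByPartner : F → Set
NoCommonShiftByPartner a = ∀ X → H a X → ∀ X′ → dist X X′ ≡ 4 → H a X′ →
  ∀ d → cubeSum d X ≡ cubeSum d X′ → NoParityPartner d (cubeSum d X) X X′

noCommonShiftByPartner : ∀ a → NoCommonShiftByPartner a
noCommonShiftByPartner = from-yes (all? λ a →
  allSubset? λ X → H? a X →-dec allSubset? λ X′ → (dist X X′ ℕ.≟ 4) →-dec H? a X′ →-dec
  all? λ d → (cubeSum d X ≟ cubeSum d X′) →-dec noParityPartner? d (cubeSum d X) X X′)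

noCommonShift : ∀ a X X′ → H a X → H a X′ → dist X X′ ≡ 4 →
  ∀ b c → b ≢ c → pairParity b c X ≡ pairParity b c X′ →
  ∀ d → cubeSum d X ≡ pairCubeSum d b c → cubeSum d X′ ≢ pairCubeSum d b c
noCommonShift a X X′ hX hX′ dist≡4 b c b≢c same-parity d σX≡ σX′≡ =
  noCommonShiftByPartner a X hX X′ dist≡4 hX′ d (trans σX≡ (sym σX′≡)) b
    (subst (b ≢_) c≡partner b≢c)
    (subst (λ c′ → pairParity b c′ X ≡ pairParity b c′ X′) c≡partner same-parity)
  where
  c≡partner : c ≡ cubeRoot (cubeSum d X +F cube (b +F d)) +F d
  c≡partner = partner-unique d b c (cubeSum d X) σX≡

mainTheorem9 : (α : F) → Primitive α → (k r s : Exp) → ¬ (r ≡ s) →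
    (X X′ : Word) → H (pow α k) X → H (pow α k) X′ → dist X X′ ≡ 4 →
    SameComponent (H (pow α k)) (pow α r) (pow α s) X X′ →
    ¬ (Σ Exp (λ l → H (pow α l) (X ⊕ e (pow α r) ⊕ e (pow α s))
                    × H (pow α l) (X′ ⊕ e (pow α r) ⊕ e (pow α s))))
mainTheorem9 α pr k r s r≢s X X′ hX hX′ dist≡4 (_ , _ , path) (l , hY , hY′) =
  let a = pow α k; b = pow α r; c = pow α s; d = pow α l in
  noCommonShift a X X′ hX hX′ dist≡4 b c (r≢s ∘ pow-injective pr r s)
    (component-pairParity (H a) b c path)
    d (shifted-codeword d X b c hY) (shifted-codeword d X′ b c hY′)
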